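{- Let $G$ be a finite simple connected graph with vertex set $\{1,\dots,n\}$. Suppose $\{i,j\}$ is not an edge of $G$, and let $G'$ be the graph obtained by adding the edge $\{i,j\}$ to $G$. Let $K=(L_G+J)^{ -1}$ and $K'=(L_{G'}+J)^{ -1}$ be the Gram matrices of $G$ and $G'$. Then $K_{l,l}\ge K'_{l,l}$ for every $l\in\{1,\dots,n\}$.
   Context: $L_H=D_H-A_H$ denotes the Laplacian of a graph $H$ ($A_H$ adjacency matrix, $D_H$ degree matrix), and $J$ is the all-ones matrix. -}

module Defs where

open import Data.Nat using (ℕ; zero; suc)
open import Data.Fin using (Fin; zero; suc)
import Data.Fin as Fin
open import Data.Bool using (Bool; true; false; if_then_else_; _∨_; _∧_)
open import Data.Rational using (ℚ; 0ℚ; 1ℚ; _+_; _*_; -_)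
import Data.Rational as ℚ
open import Relation.Binary.PropositionalEquality using (_≡_)
open import Relation.Nullary using (does)
open import Data.Product using (_×_)

record SimpleGraph (n : ℕ) : Set where
  field
    adj       : Fin n → Fin n → Bool
    symmetric : ∀ u v → adj u v ≡ adj v u
    loopless  : ∀ v → adj v v ≡ false
open SimpleGraph public

data Reachable {n : ℕ} (G : SimpleGraph n) : Fin n → Fin n → Set where
  here : ∀ {u} → Reachable G u u
  step : ∀ {u v w} → adj G u v ≡ true → Reachable G v w → Reachable G u w

Connected : ∀ {n} → SimpleGraph n → Set
Connected {n} G = ∀ (u v : Fin n) → Reachable G u v

_≟ᶠ_ : ∀ {n} → Fin n → Fin n → Bool
x ≟ᶠ y = does (x Fin.≟ y)

addAdj : ∀ {n} → SimpleGraph n → Fin n → Fin n → Fin n → Fin n → Bool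
addAdj G i j x y = adj G x y ∨ ((x ≟ᶠ i ∧ y ≟ᶠ j) ∨ (x ≟ᶠ j ∧ y ≟ᶠ i))

Matrix : ℕ → Set
Matrix n = Fin n → Fin n → ℚ

sumℚ : ∀ {n} → (Fin n → ℚ) → ℚ
sumℚ {zero}  f = 0ℚ
sumℚ {suc n} f = f zero + sumℚ (λ k → f (suc k))

_⊗_ : ∀ {n} → Matrix n → Matrix n → Matrix n
(A ⊗ B) x y = sumℚ (λ k → A x k * B k y)

identity : ∀ {n} → Matrix n
identity x y = if x ≟ᶠ y then 1ℚ else 0ℚ

allOnes : ∀ {n} → Matrix n
allOnes _ _ = 1ℚ

boolℚ : Bool → ℚ
boolℚ true  = 1ℚ
boolℚ false = 0ℚ

adjMatrix : ∀ {n} → SimpleGraph n → Matrix n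
adjMatrix G x y = boolℚ (adj G x y)

degree : ∀ {n} → SimpleGraph n → Fin n → ℚ
degree G x = sumℚ (λ y → adjMatrix G x y)

degMatrix : ∀ {n} → SimpleGraph n → Matrix n
degMatrix G x y = if x ≟ᶠ y then degree G x else 0ℚ

laplacian : ∀ {n} → SimpleGraph n → Matrix n
laplacian G x y = degMatrix G x y ℚ.- adjMatrix G x y

laplacianPlusJ : ∀ {n} → SimpleGraph n → Matrix n
laplacianPlusJ G x y = laplacian G x y + allOnes x y

IsInverse : ∀ {n} → Matrix n → Matrix n → Set
IsInverse M K = (∀ x y → (M ⊗ K) x y ≡ identity x y) × (∀ x y → (K ⊗ M) x y ≡ identity x y)

-- Adding the edge {i,j} turns M = L_G + J into M' = M + b bᵀ with b = e_i - e_j.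
-- From K' M' = 1 and M K = 1 one gets K = K' M' K = K' + (K' b)(bᵀ K) (Sherman–Morrison).
-- K is symmetric because M is, and applying the identity to b gives K b = (1 + s) K' b
-- with s = bᵀ K b = (K b)ᵀ M (K b) ≥ 0, since vᵀ L_G v = ½ Σ a_yk (v_y - v_k)² and
-- vᵀ J v = (Σ v)². Hence K_ll = K'_ll + (K' b)_l² (1 + s) ≥ K'_ll.

module Submission where

open import Data.Nat using (ℕ; zero; suc)
open import Data.Fin using (Fin; zero; suc)
import Data.Fin as Fin
open import Data.Bool using (true; false; T; if_then_else_; _∧_; _∨_)
open import Data.Bool.Properties using (T-∧; T-∨; ∨-identityʳ)
open import Data.Product using (_×_; _,_)
import Data.Product as Product
open import Data.Vec.Functional using (Vector)
open import Function.Bundles using (Equivalence)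
open import Data.Rational using (ℚ; 0ℚ; 1ℚ; ½; _+_; _*_; _-_; _≤_; nonNegative; nonPositive)
open import Data.Rational.Properties
open import Data.Rational.Solver using (module +-*-Solver)
open import Data.Sum using (inj₁; inj₂)
open import Algebra.Bundles using (CommutativeRing)
open import Algebra.Properties.Semiring.Sum (CommutativeRing.semiring +-*-commutativeRing)
  using (sum; sum-cong-≗; sum-replicate-zero; ∑-distrib-+; ∑-comm; *-distribˡ-sum; *-distribʳ-sum)
open import Function using (_∘_)
open import Relation.Binary.PropositionalEquality
open import Relation.Nullary using (yes; no)
open import Relation.Nullary.Decidable using (dec-true; dec-false)
open import Defs
open +-*-Solver
open ≡-Reasoning

private
  variable
    n : ℕ

-- The summation lemmas come from the library's sum, which agrees with sumℚ only propositionally.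
sumℚ≡sum : (f : Vector ℚ n) → sumℚ f ≡ sum f
sumℚ≡sum {zero}  f = refl
sumℚ≡sum {suc n} f = cong (f zero +_) (sumℚ≡sum (f ∘ suc))

+-nonneg : ∀ {p q} → 0ℚ ≤ p → 0ℚ ≤ q → 0ℚ ≤ p + q
+-nonneg {p} {q} p≥0 q≥0 =
  nonNegative⁻¹ (p + q) {{nonNeg+nonNeg⇒nonNeg p {{nonNegative p≥0}} q {{nonNegative q≥0}}}}

*-nonneg : ∀ {p q} → 0ℚ ≤ p → 0ℚ ≤ q → 0ℚ ≤ p * q
*-nonneg {p} {q} p≥0 q≥0 =
  nonNegative⁻¹ (p * q) {{nonNeg*nonNeg⇒nonNeg p {{nonNegative p≥0}} q {{nonNegative q≥0}}}}

p≤p+q : ∀ p {q} → 0ℚ ≤ q → p ≤ p + q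
p≤p+q p {q} q≥0 = subst (_≤ p + q) (+-identityʳ p) (+-monoʳ-≤ p q≥0)

sum-nonneg : (f : Vector ℚ n) → (∀ k → 0ℚ ≤ f k) → 0ℚ ≤ sum f
sum-nonneg {zero}  f f≥0 = ≤-refl
sum-nonneg {suc n} f f≥0 = +-nonneg (f≥0 zero) (sum-nonneg (f ∘ suc) (f≥0 ∘ suc))

square-nonneg : ∀ p → 0ℚ ≤ p * p
square-nonneg p with ≤-total 0ℚ p
... | inj₁ p≥0 = *-nonneg p≥0 p≥0
... | inj₂ p≤0 = nonNegative⁻¹ (p * p) {{nonPos*nonPos⇒nonPos p {{nonPositive p≤0}} p {{nonPositive p≤0}}}}

-- Matrices and vectors

infix  4 _≐_
infix  7 _∙_
infixr 8 _*ᵥ_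
infixl 8 _ᵥ*_
infix  30 _ᵀ

_≐_ : Matrix n → Matrix n → Set
A ≐ B = ∀ x y → A x y ≡ B x y

_ᵀ : Matrix n → Matrix n
(A ᵀ) x y = A y x

_∙_ : Vector ℚ n → Vector ℚ n → ℚ
u ∙ v = sum (λ k → u k * v k)

_*ᵥ_ : Matrix n → Vector ℚ n → Vector ℚ n
(A *ᵥ v) x = A x ∙ v

_ᵥ*_ : Vector ℚ n → Matrix n → Vector ℚ n
(u ᵥ* A) y = u ∙ (A ᵀ) y

IsSymmetric : Matrix n → Set
IsSymmetric A = A ᵀ ≐ A

IsPositiveSemidefinite : Matrix n → Set
IsPositiveSemidefinite {n} A = (v : Vector ℚ n) → 0ℚ ≤ v ∙ (A *ᵥ v)

∙-congʳ : ∀ (u : Vector ℚ n) {v w} → (∀ k → v k ≡ w k) → u ∙ v ≡ u ∙ w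
∙-congʳ u v≗w = sum-cong-≗ (λ k → cong (u k *_) (v≗w k))

∙-congˡ : ∀ {u v : Vector ℚ n} (w : Vector ℚ n) → (∀ k → u k ≡ v k) → u ∙ w ≡ v ∙ w
∙-congˡ w u≗v = sum-cong-≗ (λ k → cong (_* w k) (u≗v k))

∙-comm : (u v : Vector ℚ n) → u ∙ v ≡ v ∙ u
∙-comm u v = sum-cong-≗ (λ k → *-comm (u k) (v k))

⊗≡∙ : (A B : Matrix n) → ∀ x y → (A ⊗ B) x y ≡ A x ∙ (B ᵀ) y
⊗≡∙ A B x y = sumℚ≡sum (λ k → A x k * B k y)

∙-*ᵥ-assoc : (u : Vector ℚ n) (A : Matrix n) (v : Vector ℚ n) → u ∙ (A *ᵥ v) ≡ (u ᵥ* A) ∙ v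
∙-*ᵥ-assoc {n} u A v = begin
  sum (λ a → u a * sum (λ k → A a k * v k))      ≡⟨ sum-cong-≗ (λ a → *-distribˡ-sum {n} (u a) _) ⟩
  sum (λ a → sum (λ k → u a * (A a k * v k)))    ≡⟨ ∑-comm {n} {n} (λ a k → u a * (A a k * v k)) ⟩
  sum (λ k → sum (λ a → u a * (A a k * v k)))    ≡⟨ sum-cong-≗ (λ k → pull-out k) ⟩
  sum (λ k → sum (λ a → u a * A a k) * v k)      ∎
  where
  pull-out : ∀ k → sum (λ a → u a * (A a k * v k)) ≡ sum (λ a → u a * A a k) * v k
  pull-out k = trans (sum-cong-≗ (λ a → sym (*-assoc (u a) (A a k) (v k))))
                     (sym (*-distribʳ-sum {n} (v k) (λ a → u a * A a k)))

∙-linearʳ : (u v w : Vector ℚ n) (c : ℚ) → u ∙ (λ k → v k + w k * c) ≡ u ∙ v + (u ∙ w) * c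
∙-linearʳ {n} u v w c = begin
  sum (λ k → u k * (v k + w k * c))         ≡⟨ sum-cong-≗ (λ k → expand (u k) (v k) (w k)) ⟩
  sum (λ k → u k * v k + (u k * w k) * c)   ≡⟨ ∑-distrib-+ {n} _ _ ⟩
  u ∙ v + sum (λ k → (u k * w k) * c)       ≡⟨ cong (u ∙ v +_) (*-distribʳ-sum {n} c _) ⟨
  u ∙ v + (u ∙ w) * c                        ∎
  where
  expand : ∀ p q r → p * (q + r * c) ≡ p * q + (p * r) * c
  expand p q r = solve 4 (λ p q r t → p :* (q :+ r :* t) := p :* q :+ (p :* r) :* t) refl p q r c

∙-linearˡ : (c : ℚ) (u v w : Vector ℚ n) → (λ k → u k + c * v k) ∙ w ≡ u ∙ w + c * (v ∙ w)
∙-linearˡ {n} c u v w = begin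
  sum (λ k → (u k + c * v k) * w k)         ≡⟨ sum-cong-≗ (λ k → expand (u k) (v k) (w k)) ⟩
  sum (λ k → u k * w k + c * (v k * w k))   ≡⟨ ∑-distrib-+ {n} _ _ ⟩
  u ∙ w + sum (λ k → c * (v k * w k))       ≡⟨ cong (u ∙ w +_) (*-distribˡ-sum {n} c _) ⟨
  u ∙ w + c * (v ∙ w)                        ∎
  where
  expand : ∀ p q r → (p + c * q) * r ≡ p * r + c * (q * r)
  expand p q r = solve 4 (λ t p q r → (p :+ t :* q) :* r := p :* r :+ t :* (q :* r)) refl c p q r

≟ᶠ-sound : (x y : Fin n) → T (x ≟ᶠ y) → x ≡ y
≟ᶠ-sound x y t with x Fin.≟ y
... | yes x≡y = x≡y

≟ᶠ-∧-sound : (x y k l : Fin n) → T (x ≟ᶠ k ∧ y ≟ᶠ l) → x ≡ k × y ≡ l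
≟ᶠ-∧-sound x y k l = Product.map (≟ᶠ-sound x k) (≟ᶠ-sound y l) ∘ Equivalence.to T-∧

≟ᶠ-sym : (x y : Fin n) → x ≟ᶠ y ≡ y ≟ᶠ x
≟ᶠ-sym x y with x Fin.≟ y
... | yes refl = sym (dec-true (x Fin.≟ x) refl)
... | no x≢y   = sym (dec-false (y Fin.≟ x) (x≢y ∘ sym))

identity-symmetric : IsSymmetric (identity {n})
identity-symmetric x y = cong (λ c → if c then 1ℚ else 0ℚ) (≟ᶠ-sym y x)

identity≡boolℚ : (x y : Fin n) → identity x y ≡ boolℚ (x ≟ᶠ y)
identity≡boolℚ x y with x ≟ᶠ y
... | true  = refl
... | false = refl

identity-∙ : (x : Fin n) (v : Vector ℚ n) → identity x ∙ v ≡ v x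
identity-∙ {suc n} zero v = begin
  1ℚ * v zero + sum (λ k → 0ℚ * v (suc k))  ≡⟨ cong₂ _+_ (*-identityˡ (v zero))
                                                         (sum-cong-≗ {n} (λ k → *-zeroˡ (v (suc k)))) ⟩
  v zero + sum {n} (λ _ → 0ℚ)                ≡⟨ cong (v zero +_) (sum-replicate-zero n) ⟩
  v zero + 0ℚ                                ≡⟨ +-identityʳ (v zero) ⟩
  v zero                                     ∎
identity-∙ {suc n} (suc x) v =
  trans (cong (_+ identity x ∙ (v ∘ suc)) (*-zeroˡ (v zero)))
        (trans (+-identityˡ _) (identity-∙ x (v ∘ suc)))

∙-identityᵀ : (v : Vector ℚ n) (x : Fin n) → v ∙ (identity ᵀ) x ≡ v x
∙-identityᵀ v x =
  trans (∙-comm v ((identity ᵀ) x)) (trans (∙-congˡ v (identity-symmetric x)) (identity-∙ x v))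

identity-transfer : (x k y : Fin n) → identity x k * identity x y ≡ identity x k * identity y k
identity-transfer x k y with x Fin.≟ k
... | yes refl = cong (1ℚ *_) (identity-symmetric y x)
... | no _     = trans (*-zeroˡ (identity x y)) (sym (*-zeroˡ (identity y k)))

⊗-congˡ : (A : Matrix n) {B C : Matrix n} → B ≐ C → A ⊗ B ≐ A ⊗ C
⊗-congˡ {n} A {B} {C} B≐C x y = begin
  (A ⊗ B) x y      ≡⟨ ⊗≡∙ A B x y ⟩
  A x ∙ (B ᵀ) y    ≡⟨ ∙-congʳ (A x) (λ k → B≐C k y) ⟩
  A x ∙ (C ᵀ) y    ≡⟨ ⊗≡∙ A C x y ⟨
  (A ⊗ C) x y      ∎

⊗-congʳ : {A B : Matrix n} (C : Matrix n) → A ≐ B → A ⊗ C ≐ B ⊗ C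
⊗-congʳ {n} {A} {B} C A≐B x y = begin
  (A ⊗ C) x y      ≡⟨ ⊗≡∙ A C x y ⟩
  A x ∙ (C ᵀ) y    ≡⟨ ∙-congˡ ((C ᵀ) y) (A≐B x) ⟩
  B x ∙ (C ᵀ) y    ≡⟨ ⊗≡∙ B C x y ⟨
  (B ⊗ C) x y      ∎

⊗-assoc : (A B C : Matrix n) → (A ⊗ B) ⊗ C ≐ A ⊗ (B ⊗ C)
⊗-assoc A B C x y = begin
  ((A ⊗ B) ⊗ C) x y            ≡⟨ ⊗≡∙ (A ⊗ B) C x y ⟩
  (A ⊗ B) x ∙ (C ᵀ) y          ≡⟨ ∙-congˡ ((C ᵀ) y) (⊗≡∙ A B x) ⟩
  (A x ᵥ* B) ∙ (C ᵀ) y         ≡⟨ ∙-*ᵥ-assoc (A x) B ((C ᵀ) y) ⟨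
  A x ∙ (B *ᵥ (C ᵀ) y)         ≡⟨ ∙-congʳ (A x) (λ k → ⊗≡∙ B C k y) ⟨
  A x ∙ ((B ⊗ C) ᵀ) y          ≡⟨ ⊗≡∙ A (B ⊗ C) x y ⟨
  (A ⊗ (B ⊗ C)) x y            ∎

⊗-identityˡ : (A : Matrix n) → identity ⊗ A ≐ A
⊗-identityˡ A x y = trans (⊗≡∙ identity A x y) (identity-∙ x ((A ᵀ) y))

⊗-identityʳ : (A : Matrix n) → A ⊗ identity ≐ A
⊗-identityʳ A x y = trans (⊗≡∙ A identity x y) (∙-identityᵀ (A x) y)

⊗-transpose : (A B : Matrix n) → (A ⊗ B) ᵀ ≐ B ᵀ ⊗ A ᵀ
⊗-transpose A B x y = begin
  (A ⊗ B) y x             ≡⟨ ⊗≡∙ A B y x ⟩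
  A y ∙ (B ᵀ) x           ≡⟨ ∙-comm (A y) ((B ᵀ) x) ⟩
  (B ᵀ) x ∙ A y           ≡⟨ ⊗≡∙ (B ᵀ) (A ᵀ) x y ⟨
  (B ᵀ ⊗ A ᵀ) x y         ∎

*ᵥ-assoc : (A B : Matrix n) (v : Vector ℚ n) → ∀ x → (A *ᵥ B *ᵥ v) x ≡ ((A ⊗ B) *ᵥ v) x
*ᵥ-assoc A B v x = trans (∙-*ᵥ-assoc (A x) B v) (∙-congˡ v (λ k → sym (⊗≡∙ A B x k)))

leftInverse≐rightInverse : {P M K : Matrix n} → P ⊗ M ≐ identity → M ⊗ K ≐ identity → P ≐ K
leftInverse≐rightInverse {P = P} {M} {K} PM≐I MK≐I x y = begin
  P x y                   ≡⟨ ⊗-identityʳ P x y ⟨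
  (P ⊗ identity) x y      ≡⟨ ⊗-congˡ P MK≐I x y ⟨
  (P ⊗ (M ⊗ K)) x y       ≡⟨ ⊗-assoc P M K x y ⟨
  ((P ⊗ M) ⊗ K) x y       ≡⟨ ⊗-congʳ K PM≐I x y ⟩
  (identity ⊗ K) x y      ≡⟨ ⊗-identityˡ K x y ⟩
  K x y                   ∎

inverse-symmetric : {M K : Matrix n} → IsSymmetric M → IsInverse M K → IsSymmetric K
inverse-symmetric {M = M} {K} M-sym (MK≐I , _) = leftInverse≐rightInverse Kᵀ⊗M≐I MK≐I
  where
  Kᵀ⊗M≐I : K ᵀ ⊗ M ≐ identity
  Kᵀ⊗M≐I x y = begin
    (K ᵀ ⊗ M) x y         ≡⟨ ⊗-congˡ (K ᵀ) (λ a b → sym (M-sym a b)) x y ⟩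
    (K ᵀ ⊗ M ᵀ) x y       ≡⟨ ⊗-transpose M K x y ⟨
    (M ⊗ K) y x           ≡⟨ MK≐I y x ⟩
    identity y x          ≡⟨ identity-symmetric x y ⟩
    identity x y          ∎

-- Rank-one updates

inverse-rankOneUpdate : (M K M' K' : Matrix n) (b : Vector ℚ n) →
  (∀ x y → M' x y ≡ M x y + b x * b y) → M ⊗ K ≐ identity → K' ⊗ M' ≐ identity →
  ∀ x y → K x y ≡ K' x y + (K' *ᵥ b) x * (b ᵥ* K) y
inverse-rankOneUpdate M K M' K' b M'≡M+bbᵀ MK≐I K'M'≐I x y = begin
  K x y                                  ≡⟨ ⊗-identityˡ K x y ⟨
  (identity ⊗ K) x y                     ≡⟨ ⊗-congʳ K K'M'≐I x y ⟨
  ((K' ⊗ M') ⊗ K) x y                    ≡⟨ ⊗-assoc K' M' K x y ⟩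
  (K' ⊗ (M' ⊗ K)) x y                    ≡⟨ ⊗≡∙ K' (M' ⊗ K) x y ⟩
  K' x ∙ (λ m → (M' ⊗ K) m y)            ≡⟨ ∙-congʳ (K' x) M'K≡I+bw ⟩
  K' x ∙ (λ m → identity m y + b m * w)  ≡⟨ ∙-linearʳ (K' x) ((identity ᵀ) y) b w ⟩
  K' x ∙ (identity ᵀ) y + (K' *ᵥ b) x * w ≡⟨ cong (_+ (K' *ᵥ b) x * w) (∙-identityᵀ (K' x) y) ⟩
  K' x y + (K' *ᵥ b) x * w               ∎
  where
  w = (b ᵥ* K) y
  M'K≡I+bw : ∀ m → (M' ⊗ K) m y ≡ identity m y + b m * w
  M'K≡I+bw m = begin
    (M' ⊗ K) m y                         ≡⟨ ⊗≡∙ M' K m y ⟩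
    M' m ∙ (K ᵀ) y                       ≡⟨ ∙-congˡ ((K ᵀ) y) (M'≡M+bbᵀ m) ⟩
    (λ k → M m k + b m * b k) ∙ (K ᵀ) y  ≡⟨ ∙-linearˡ (b m) (M m) b ((K ᵀ) y) ⟩
    M m ∙ (K ᵀ) y + b m * w              ≡⟨ cong (_+ b m * w) (trans (sym (⊗≡∙ M K m y)) (MK≐I m y)) ⟩
    identity m y + b m * w               ∎

rankOneUpdate-inverse-diagonal-≤ : (M K M' K' : Matrix n) (b : Vector ℚ n) →
  IsSymmetric M → IsPositiveSemidefinite M → IsInverse M K →
  (∀ x y → M' x y ≡ M x y + b x * b y) → K' ⊗ M' ≐ identity →
  ∀ l → K' l l ≤ K l l
rankOneUpdate-inverse-diagonal-≤ M K M' K' b M-sym M-psd K-inv@(MK≐I , _) M'≡M+bbᵀ K'M'≐I l =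
  subst (K' l l ≤_) (sym K≡K'+u'²[1+s])
    (p≤p+q (K' l l) (*-nonneg (square-nonneg (u' l)) (+-nonneg (nonNegative⁻¹ 1ℚ) s≥0)))
  where
  u u' : Vector ℚ _
  u  = K *ᵥ b
  u' = K' *ᵥ b
  s : ℚ
  s = u ∙ b

  bK≡u : ∀ y → (b ᵥ* K) y ≡ u y
  bK≡u y = trans (∙-comm b ((K ᵀ) y)) (∙-congˡ b (inverse-symmetric M-sym K-inv y))

  K≡K'+u'u : ∀ x y → K x y ≡ K' x y + u' x * u y
  K≡K'+u'u x y = trans (inverse-rankOneUpdate M K M' K' b M'≡M+bbᵀ MK≐I K'M'≐I x y)
                       (cong (λ t → K' x y + u' x * t) (bK≡u y))

  u≡u'[1+s] : ∀ x → u x ≡ u' x * (1ℚ + s)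
  u≡u'[1+s] x = begin
    K x ∙ b                                  ≡⟨ ∙-congˡ b (K≡K'+u'u x) ⟩
    (λ y → K' x y + u' x * u y) ∙ b          ≡⟨ ∙-linearˡ (u' x) (K' x) u b ⟩
    u' x + u' x * s                          ≡⟨ solve 2 (λ p t → p :+ p :* t := p :* (con 1ℚ :+ t)) refl (u' x) s ⟩
    u' x * (1ℚ + s)                          ∎

  s≥0 : 0ℚ ≤ s
  s≥0 = subst (0ℚ ≤_) (∙-congʳ u Mu≡b) (M-psd u)
    where
    Mu≡b : ∀ x → (M *ᵥ u) x ≡ b x
    Mu≡b x = trans (*ᵥ-assoc M K b x) (trans (∙-congˡ b (MK≐I x)) (identity-∙ x b))

  K≡K'+u'²[1+s] : K l l ≡ K' l l + u' l * u' l * (1ℚ + s)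
  K≡K'+u'²[1+s] = trans (K≡K'+u'u l l)
    (cong (K' l l +_) (trans (cong (u' l *_) (u≡u'[1+s] l)) (sym (*-assoc (u' l) (u' l) (1ℚ + s)))))

-- Laplacians

degMatrix≡degree*identity : (G : SimpleGraph n) (x y : Fin n) → degMatrix G x y ≡ degree G x * identity x y
degMatrix≡degree*identity G x y with x ≟ᶠ y
... | true  = sym (*-identityʳ (degree G x))
... | false = sym (*-zeroʳ (degree G x))

degMatrix-symmetric : (G : SimpleGraph n) → IsSymmetric (degMatrix G)
degMatrix-symmetric G x y with y Fin.≟ x
... | yes refl rewrite dec-true (x Fin.≟ x) refl = refl
... | no y≢x   rewrite dec-false (x Fin.≟ y) (y≢x ∘ sym) = refl

laplacianPlusJ-symmetric : (G : SimpleGraph n) → IsSymmetric (laplacianPlusJ G)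
laplacianPlusJ-symmetric G x y =
  cong₂ (λ d a → d - a + 1ℚ) (degMatrix-symmetric G x y) (cong boolℚ (symmetric G y x))

laplacianPlusJ-*ᵥ : (G : SimpleGraph n) (v : Vector ℚ n) (y : Fin n) →
  (laplacianPlusJ G *ᵥ v) y ≡ sum (λ k → adjMatrix G y k * (v y - v k) + v k)
laplacianPlusJ-*ᵥ {n} G v y = begin
  sum (λ k → laplacianPlusJ G y k * v k)                     ≡⟨ sum-cong-≗ {n} expand ⟩
  sum (λ k → d * (identity y k * v k) + (v k - a y k * v k))  ≡⟨ ∑-distrib-+ {n} _ _ ⟩
  sum (λ k → d * (identity y k * v k)) + r                   ≡⟨ cong (_+ r) (*-distribˡ-sum {n} d _) ⟨
  d * (identity y ∙ v) + r                                   ≡⟨ cong (λ t → d * t + r) (identity-∙ y v) ⟩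
  d * v y + r                                                ≡⟨ cong (λ t → t * v y + r) (sumℚ≡sum (a y)) ⟩
  sum (a y) * v y + r                                        ≡⟨ cong (_+ r) (*-distribʳ-sum {n} (v y) (a y)) ⟩
  sum (λ k → a y k * v y) + r                                ≡⟨ ∑-distrib-+ {n} _ _ ⟨
  sum (λ k → a y k * v y + (v k - a y k * v k))              ≡⟨ sum-cong-≗ {n} regroup ⟩
  sum (λ k → a y k * (v y - v k) + v k)                      ∎
  where
  a = adjMatrix G
  d = degree G y
  r = sum (λ k → v k - a y k * v k)
  expand : ∀ k → laplacianPlusJ G y k * v k ≡ d * (identity y k * v k) + (v k - a y k * v k)
  expand k =
    trans (cong (λ t → (t - a y k + 1ℚ) * v k) (degMatrix≡degree*identity G y k))
    (solve 4 (λ d e c w → (d :* e :- c :+ con 1ℚ) :* w := d :* (e :* w) :+ (w :- c :* w)) refl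
      d (identity y k) (a y k) (v k))
  regroup : ∀ k → a y k * v y + (v k - a y k * v k) ≡ a y k * (v y - v k) + v k
  regroup k = solve 3 (λ c p q → c :* p :+ (q :- c :* q) := c :* (p :- q) :+ q) refl (a y k) (v y) (v k)

-- vᵀ L_G v
laplacianForm : SimpleGraph n → Vector ℚ n → ℚ
laplacianForm G v = sum (λ y → sum (λ k → adjMatrix G y k * (v y * (v y - v k))))

laplacianForm-nonneg : (G : SimpleGraph n) (v : Vector ℚ n) → 0ℚ ≤ laplacianForm G v
laplacianForm-nonneg {n} G v =
  subst (0ℚ ≤_) (solve 1 (λ t → con ½ :* (t :+ t) := t) refl Q)
    (*-nonneg (nonNegative⁻¹ ½) (subst (0ℚ ≤_) (sym Q+Q≡sumOfSquares) sumOfSquares-nonneg))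
  where
  a = adjMatrix G
  Q = laplacianForm G v
  f : Fin n → Fin n → ℚ
  f y k = a y k * (v y * (v y - v k))

  boolℚ-nonneg : ∀ c → 0ℚ ≤ boolℚ c
  boolℚ-nonneg true  = nonNegative⁻¹ 1ℚ
  boolℚ-nonneg false = ≤-refl

  symmetrize : ∀ y k → f y k + f k y ≡ a y k * ((v y - v k) * (v y - v k))
  symmetrize y k =
    trans (cong (λ c → f y k + c * (v k * (v k - v y))) (cong boolℚ (symmetric G k y)))
    (solve 3 (λ c p q → c :* (p :* (p :- q)) :+ c :* (q :* (q :- p)) := c :* ((p :- q) :* (p :- q))) refl
      (a y k) (v y) (v k))

  sumOfSquares-nonneg : 0ℚ ≤ sum (λ y → sum (λ k → a y k * ((v y - v k) * (v y - v k))))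
  sumOfSquares-nonneg = sum-nonneg _ (λ y → sum-nonneg _ (λ k →
    *-nonneg (boolℚ-nonneg (adj G y k)) (square-nonneg (v y - v k))))

  Q+Q≡sumOfSquares : Q + Q ≡ sum (λ y → sum (λ k → a y k * ((v y - v k) * (v y - v k))))
  Q+Q≡sumOfSquares = begin
    Q + Q                                                  ≡⟨ cong (Q +_) (∑-comm {n} {n} f) ⟩
    Q + sum (λ y → sum (λ k → f k y))                      ≡⟨ ∑-distrib-+ {n} _ _ ⟨
    sum (λ y → sum (λ k → f y k) + sum (λ k → f k y))      ≡⟨ sum-cong-≗ {n} (λ y → ∑-distrib-+ {n} (f y) _) ⟨
    sum (λ y → sum (λ k → f y k + f k y))                  ≡⟨ sum-cong-≗ {n} (λ y → sum-cong-≗ {n} (symmetrize y)) ⟩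
    sum (λ y → sum (λ k → a y k * ((v y - v k) * (v y - v k)))) ∎

laplacianPlusJ-form : (G : SimpleGraph n) (v : Vector ℚ n) →
  v ∙ (laplacianPlusJ G *ᵥ v) ≡ laplacianForm G v + sum v * sum v
laplacianPlusJ-form {n} G v = begin
  sum (λ y → v y * (laplacianPlusJ G *ᵥ v) y)                      ≡⟨ ∙-congʳ v (laplacianPlusJ-*ᵥ G v) ⟩
  sum (λ y → v y * sum (λ k → a y k * (v y - v k) + v k))          ≡⟨ sum-cong-≗ {n} distribute ⟩
  sum (λ y → sum (λ k → a y k * (v y * (v y - v k))) + v y * sum v) ≡⟨ ∑-distrib-+ {n} _ _ ⟩
  laplacianForm G v + sum (λ y → v y * sum v)                      ≡⟨ cong (laplacianForm G v +_) (*-distribʳ-sum {n} (sum v) v) ⟨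
  laplacianForm G v + sum v * sum v                                ∎
  where
  a = adjMatrix G
  distribute : ∀ y → v y * sum (λ k → a y k * (v y - v k) + v k)
                   ≡ sum (λ k → a y k * (v y * (v y - v k))) + v y * sum v
  distribute y = begin
    v y * sum (λ k → a y k * (v y - v k) + v k)          ≡⟨ *-distribˡ-sum {n} (v y) _ ⟩
    sum (λ k → v y * (a y k * (v y - v k) + v k))        ≡⟨ sum-cong-≗ {n} (λ k → expand (a y k) (v y) (v k)) ⟩
    sum (λ k → f k + v y * v k)                          ≡⟨ ∑-distrib-+ {n} _ _ ⟩
    sum f + sum (λ k → v y * v k)                        ≡⟨ cong (sum f +_) (*-distribˡ-sum {n} (v y) v) ⟨
    sum f + v y * sum v                                  ∎
    where
    f = λ k → a y k * (v y * (v y - v k))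
    expand : ∀ c p q → p * (c * (p - q) + q) ≡ c * (p * (p - q)) + p * q
    expand = solve 3 (λ c p q → p :* (c :* (p :- q) :+ q) := c :* (p :* (p :- q)) :+ p :* q) refl

laplacianPlusJ-positiveSemidefinite : (G : SimpleGraph n) → IsPositiveSemidefinite (laplacianPlusJ G)
laplacianPlusJ-positiveSemidefinite G v =
  subst (0ℚ ≤_) (sym (laplacianPlusJ-form G v))
    (+-nonneg (laplacianForm-nonneg G v) (square-nonneg (sum v)))

-- Adding an edge

edgeMatrix : Fin n → Fin n → Matrix n
edgeMatrix i j x y = identity x i * identity y j + identity x j * identity y i

edgeVector : Fin n → Fin n → Vector ℚ n
edgeVector i j x = identity x i - identity x j

edgeMatrix-rowSum : (i j x : Fin n) → sum (edgeMatrix i j x) ≡ identity x i + identity x j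
edgeMatrix-rowSum {n} i j x = trans (∑-distrib-+ {n} _ _)
  (cong₂ _+_ (∙-identityᵀ (λ _ → identity x i) j) (∙-identityᵀ (λ _ → identity x j) i))

edgeLaplacian≡outer : (i j x y : Fin n) →
  (identity x i + identity x j) * identity x y - edgeMatrix i j x y ≡ edgeVector i j x * edgeVector i j y
edgeLaplacian≡outer i j x y = begin
  (δxi + δxj) * identity x y - (δxi * δyj + δxj * δyi)   ≡⟨ cong (_- (δxi * δyj + δxj * δyi)) diagonal ⟩
  (δxi * δyi + δxj * δyj) - (δxi * δyj + δxj * δyi)     ≡⟨ factor ⟩
  (δxi - δxj) * (δyi - δyj)                              ∎
  where
  δxi = identity x i
  δxj = identity x j
  δyi = identity y i
  δyj = identity y j
  diagonal : (δxi + δxj) * identity x y ≡ δxi * δyi + δxj * δyj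
  diagonal = trans (*-distribʳ-+ (identity x y) δxi δxj)
                   (cong₂ _+_ (identity-transfer x i y) (identity-transfer x j y))
  factor : (δxi * δyi + δxj * δyj) - (δxi * δyj + δxj * δyi) ≡ (δxi - δxj) * (δyi - δyj)
  factor = solve 4 (λ p q r t → (p :* r :+ q :* t) :- (p :* t :+ q :* r) := (p :- q) :* (r :- t))
                   refl δxi δxj δyi δyj

boolℚ-∧ : ∀ p q → boolℚ (p ∧ q) ≡ boolℚ p * boolℚ q
boolℚ-∧ true  q = sym (*-identityˡ (boolℚ q))
boolℚ-∧ false q = sym (*-zeroˡ (boolℚ q))

boolℚ-∨ : ∀ p q → (T q → p ≡ false) → boolℚ (p ∨ q) ≡ boolℚ p + boolℚ q
boolℚ-∨ p false _ = trans (cong boolℚ (∨-identityʳ p)) (sym (+-identityʳ (boolℚ p)))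
boolℚ-∨ p true  q⇒¬p rewrite q⇒¬p _ = sym (+-identityˡ 1ℚ)

boolℚ-≟ᶠ-∧ : (x y k l : Fin n) → boolℚ (x ≟ᶠ k ∧ y ≟ᶠ l) ≡ identity x k * identity y l
boolℚ-≟ᶠ-∧ x y k l =
  trans (boolℚ-∧ (x ≟ᶠ k) (y ≟ᶠ l)) (sym (cong₂ _*_ (identity≡boolℚ x k) (identity≡boolℚ y l)))

module AddEdge {n} (G : SimpleGraph n) (i j : Fin n) (i≢j : i ≢ j) (ij∉G : adj G i j ≡ false)
               (G' : SimpleGraph n) (G'≡G+ij : ∀ x y → adj G' x y ≡ addAdj G i j x y) where

  endpoints-nonadjacent : ∀ x y → T ((x ≟ᶠ i ∧ y ≟ᶠ j) ∨ (x ≟ᶠ j ∧ y ≟ᶠ i)) → adj G x y ≡ false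
  endpoints-nonadjacent x y t with Equivalence.to T-∨ t
  ... | inj₁ xy≡ij with refl , refl ← ≟ᶠ-∧-sound x y i j xy≡ij = ij∉G
  ... | inj₂ xy≡ji with refl , refl ← ≟ᶠ-∧-sound x y j i xy≡ji = trans (symmetric G j i) ij∉G

  orientations-exclusive : ∀ x y → T (x ≟ᶠ j ∧ y ≟ᶠ i) → (x ≟ᶠ i ∧ y ≟ᶠ j) ≡ false
  orientations-exclusive x y t with refl , _ ← ≟ᶠ-∧-sound x y j i t =
    cong (_∧ (y ≟ᶠ j)) (dec-false (x Fin.≟ i) (i≢j ∘ sym))

  adjMatrix-addEdge : ∀ x y → adjMatrix G' x y ≡ adjMatrix G x y + edgeMatrix i j x y
  adjMatrix-addEdge x y = begin
    boolℚ (adj G' x y)                              ≡⟨ cong boolℚ (G'≡G+ij x y) ⟩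
    boolℚ (adj G x y ∨ (xy∈ij ∨ xy∈ji))             ≡⟨ boolℚ-∨ _ _ (endpoints-nonadjacent x y) ⟩
    adjMatrix G x y + boolℚ (xy∈ij ∨ xy∈ji)         ≡⟨ cong (adjMatrix G x y +_) edge ⟩
    adjMatrix G x y + edgeMatrix i j x y            ∎
    where
    xy∈ij = x ≟ᶠ i ∧ y ≟ᶠ j
    xy∈ji = x ≟ᶠ j ∧ y ≟ᶠ i
    edge : boolℚ (xy∈ij ∨ xy∈ji) ≡ edgeMatrix i j x y
    edge = trans (boolℚ-∨ _ _ (orientations-exclusive x y))
                 (cong₂ _+_ (boolℚ-≟ᶠ-∧ x y i j) (boolℚ-≟ᶠ-∧ x y j i))

  degree-addEdge : ∀ x → degree G' x ≡ degree G x + (identity x i + identity x j)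
  degree-addEdge x = begin
    degree G' x                                            ≡⟨ sumℚ≡sum (adjMatrix G' x) ⟩
    sum (adjMatrix G' x)                                   ≡⟨ sum-cong-≗ {n} (adjMatrix-addEdge x) ⟩
    sum (λ y → adjMatrix G x y + edgeMatrix i j x y)       ≡⟨ ∑-distrib-+ {n} _ _ ⟩
    sum (adjMatrix G x) + sum (edgeMatrix i j x)           ≡⟨ cong₂ _+_ (sym (sumℚ≡sum (adjMatrix G x)))
                                                                        (edgeMatrix-rowSum i j x) ⟩
    degree G x + (identity x i + identity x j)             ∎

  laplacianPlusJ-addEdge : ∀ x y →
    laplacianPlusJ G' x y ≡ laplacianPlusJ G x y + edgeVector i j x * edgeVector i j y
  laplacianPlusJ-addEdge x y = begin
    degMatrix G' x y - adjMatrix G' x y + 1ℚ                ≡⟨ cong₂ (λ d a → d - a + 1ℚ) degMatrix-addEdge (adjMatrix-addEdge x y) ⟩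
    (degree G x + c) * δxy - (adjMatrix G x y + E) + 1ℚ     ≡⟨ regroup ⟩
    (degree G x * δxy - adjMatrix G x y + 1ℚ) + (c * δxy - E) ≡⟨ cong₂ _+_ restore (edgeLaplacian≡outer i j x y) ⟩
    laplacianPlusJ G x y + edgeVector i j x * edgeVector i j y ∎
    where
    c = identity x i + identity x j
    δxy = identity x y
    E = edgeMatrix i j x y
    degMatrix-addEdge : degMatrix G' x y ≡ (degree G x + c) * δxy
    degMatrix-addEdge = trans (degMatrix≡degree*identity G' x y) (cong (_* δxy) (degree-addEdge x))
    regroup : (degree G x + c) * δxy - (adjMatrix G x y + E) + 1ℚ
            ≡ (degree G x * δxy - adjMatrix G x y + 1ℚ) + (c * δxy - E)
    regroup = solve 5 (λ d c e a E → (d :+ c) :* e :- (a :+ E) :+ con 1ℚ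
                                   := (d :* e :- a :+ con 1ℚ) :+ (c :* e :- E))
                      refl (degree G x) c δxy (adjMatrix G x y) E
    restore : degree G x * δxy - adjMatrix G x y + 1ℚ ≡ laplacianPlusJ G x y
    restore = cong (λ d → d - adjMatrix G x y + 1ℚ) (sym (degMatrix≡degree*identity G x y))

-- Connectedness of G is what makes L_G + J invertible; invertibility is assumed here.
lemma6p4 : (n : ℕ) (G : SimpleGraph n) → Connected G →
    (i j : Fin n) → i ≢ j → adj G i j ≡ false →
    (G' : SimpleGraph n) → (∀ x y → adj G' x y ≡ addAdj G i j x y) →
    (K K' : Matrix n) →
    IsInverse (laplacianPlusJ G) K → IsInverse (laplacianPlusJ G') K' →
    ∀ (l : Fin n) → K' l l ≤ K l l
lemma6p4 n G _ i j i≢j ij∉G G' G'≡G+ij K K' K-inv (_ , K'M'≐I) =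
  rankOneUpdate-inverse-diagonal-≤ (laplacianPlusJ G) K (laplacianPlusJ G') K' (edgeVector i j)
    (laplacianPlusJ-symmetric G) (laplacianPlusJ-positiveSemidefinite G) K-inv
    (AddEdge.laplacianPlusJ-addEdge G i j i≢j ij∉G G' G'≡G+ij) K'M'≐I
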